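{- Let $G$ be the grid defined in the context. For all integers $a,b\ge0$: $G(3a,2b)=\overline{G(2a,b)\,0}$, $G(3a,2b+1)=\overline{G(2a,b)\,1}$, $G(3a+1,2b)=\overline{G(2a,b)\,2}$, and $G(3a+1,2b+1)=\overline{G(2a+1,b)\,0}$, $G(3a+2,2b)=\overline{G(2a+1,b)\,1}$, $G(3a+2,2b+1)=\overline{G(2a+1,b)\,2}$, where, when the prefix is $G(0,0)=0$, it is to be read as the empty string. That is, the longest common prefix of the upperZ at positions $(3a,2b),(3a,2b+1),(3a+1,2b)$ is $G(2a,b)$, and that of the lowerZ at positions $(3a+1,2b+1),(3a+2,2b),(3a+2,2b+1)$ is $G(2a+1,b)$.
   Context: For a finite string $w=a_na_{n-1}\cdots a_0$ over digits $\{0,1,2\}$ let $[w]_{3/2}=\sum_k a_k(3/2)^k$. Define an operation $T$ on such strings ("adding 2 in base $\frac32$"): if $w$ contains no digit $0$, first replace $w$ by $0w$; then change the rightmost $0$ of $w$ into $2$, change every digit to the right of it by $1\mapsto0$, $2\mapsto1$, and leave all digits to the left of it unchanged. Then $[T(w)]_{3/2}=[w]_{3/2}+2$. The grid $G$ has entries $G(i,j)$ (row $i$, column $j$, $i,j\ge0$): $G(0,j)$ is the binary representation of $j$ (so row $0$ is $0,1,10,11,100,\dots$), and $G(i+1,j)=T(G(i,j))$. $\overline{XY}$ denotes concatenation of strings. -}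

module Defs where

open import Data.List using (List; []; _∷_; _++_; reverse)
open import Data.Nat using (ℕ; zero; suc)

-- digits of base 3/2 expansions
data Digit : Set where
  d0 d1 d2 : Digit

-- a string a_n ... a_0, stored most significant digit first
Str : Set
Str = List Digit

-- operation T on the reversed string (least significant digit first);
-- the Bool-free encoding: if no 0 is found, a leading 0 is appended
-- (i.e. prepended to the string) and turned into 2.
Trev : Str → Str
Trev []        = d2 ∷ []
Trev (d0 ∷ w)  = d2 ∷ w
Trev (d1 ∷ w)  = d0 ∷ Trev w
Trev (d2 ∷ w)  = d1 ∷ Trev w

T : Str → Str
T w = reverse (Trev (reverse w))

incRev : Str → Str
incRev []       = d1 ∷ []
incRev (d0 ∷ w) = d1 ∷ w
incRev (d1 ∷ w) = d0 ∷ incRev w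
incRev (d2 ∷ w) = d2 ∷ w          -- never used on binary strings

-- binary representation of j (row 0): 0, 1, 10, 11, 100, ...
bin : ℕ → Str
bin zero    = d0 ∷ []
bin (suc j) = reverse (incRev (reverse (bin j)))

iterate : {A : Set} → (A → A) → ℕ → A → A
iterate f zero    x = x
iterate f (suc n) x = f (iterate f n x)

G : ℕ → ℕ → Str
G i j = iterate T i (bin j)

-- concatenation  \overline{w d}, where the prefix "0" (= G(0,0)) is read as empty
cat : Str → Digit → Str
cat (d0 ∷ []) d = d ∷ []
cat w         d = w ++ (d ∷ [])

module Submission where

-- Work with strings reversed (least significant digit first),
-- where T becomes the simple recursion Trev and every string is a list
-- "last digit ∷ rest".  Two observations carry the argument:
--
--  * the cycle law: Trev acts on the last digit as the 3-cycle
--    0 ↦ 2 ↦ 1 ↦ 0 and, each time that digit passes from 1 to 0 or from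
--    2 to 1, applies Trev once to the rest; so three applications of Trev
--    to  d ∷ w  give  d ∷ Trev² w,  whatever the digit d;
--  * the convention "G(0,0) = 0 is read as empty" is a normalisation
--    strip : "0" ↦ "" that commutes with Trev and with binary increment.
--
-- Since bin(2b) and bin(2b+1) are bin b followed by the digit 0 resp. 1,
-- the cycle law gives row 3a of columns 2b, 2b+1 as row 2a of column b
-- followed by one digit; one or two more applications of Trev produce the
-- other four cases.  Reversing back turns "d ∷ rest" into concatenation.

open import Defs
open import Data.Nat using (ℕ; zero; suc; _+_; _*_)
open import Data.Nat.Properties using (*-comm; +-comm)
open import Data.Product using (_×_; _,_)
open import Data.List using ([]; _∷_; _++_; reverse)
open import Data.List.Properties
  using (reverse-involutive; reverse-selfInverse; unfold-reverse)
open import Relation.Nullary using (¬_)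
open import Relation.Binary.PropositionalEquality
  using (_≡_; refl; sym; trans; cong; module ≡-Reasoning)

-- The normalisation reading the one-digit string 0 as the empty string.
-- (A one-digit string is its own reverse, so this is meaningful in both
-- digit orders.)
strip : Str → Str
strip (d0 ∷ []) = []
strip w         = w

strip-id : ∀ w → ¬ (w ≡ d0 ∷ []) → strip w ≡ w
strip-id []           _   = refl
strip-id (d0 ∷ [])    w≢0 with () ← w≢0 refl
strip-id (d0 ∷ _ ∷ _) _   = refl
strip-id (d1 ∷ _)     _   = refl
strip-id (d2 ∷ _)     _   = refl

Commutes : (Str → Str) → Set
Commutes f = ∀ w → f (strip w) ≡ strip (f w)

iterate-commutes : ∀ {f} → Commutes f → ∀ n → Commutes (iterate f n)
iterate-commutes f-comm zero    w = refl
iterate-commutes {f} f-comm (suc n) w =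
  trans (cong f (iterate-commutes f-comm n w)) (f-comm (iterate f n w))

-- Both Trev and incRev send "" and "0" to the same string and never
-- produce "0".
Trev-commutes : Commutes Trev
Trev-commutes []            = refl
Trev-commutes (d0 ∷ [])     = refl
Trev-commutes (d0 ∷ _ ∷ _)  = refl
Trev-commutes (d1 ∷ [])     = refl
Trev-commutes (d1 ∷ d0 ∷ _) = refl
Trev-commutes (d1 ∷ d1 ∷ _) = refl
Trev-commutes (d1 ∷ d2 ∷ _) = refl
Trev-commutes (d2 ∷ _)      = refl

incRev-commutes : Commutes incRev
incRev-commutes []            = refl
incRev-commutes (d0 ∷ [])     = refl
incRev-commutes (d0 ∷ _ ∷ _)  = refl
incRev-commutes (d1 ∷ [])     = refl
incRev-commutes (d1 ∷ d0 ∷ _) = refl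
incRev-commutes (d1 ∷ d1 ∷ _) = refl
incRev-commutes (d1 ∷ d2 ∷ _) = refl
incRev-commutes (d2 ∷ _)      = refl

cycle : ∀ a d w → iterate Trev (a * 3) (d ∷ w) ≡ d ∷ iterate Trev (a * 2) w
cycle zero    d  w = refl
cycle (suc a) d0 w rewrite cycle a d0 w = refl
cycle (suc a) d1 w rewrite cycle a d1 w = refl
cycle (suc a) d2 w rewrite cycle a d2 w = refl

binrev : ℕ → Str
binrev j = reverse (bin j)

binrev-suc : ∀ j → binrev (suc j) ≡ incRev (binrev j)
binrev-suc j = reverse-involutive _

binrev-even : ∀ b → binrev (b * 2) ≡ d0 ∷ strip (binrev b)
binrev-odd  : ∀ b → binrev (suc (b * 2)) ≡ d1 ∷ strip (binrev b)
binrev-even zero    = refl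
binrev-even (suc b) = begin
  binrev (suc (suc (b * 2)))     ≡⟨ binrev-suc (suc (b * 2)) ⟩
  incRev (binrev (suc (b * 2)))  ≡⟨ cong incRev (binrev-odd b) ⟩
  d0 ∷ incRev (strip (binrev b)) ≡⟨ cong (d0 ∷_) (incRev-commutes (binrev b)) ⟩
  d0 ∷ strip (incRev (binrev b)) ≡⟨ cong (λ w → d0 ∷ strip w) (binrev-suc b) ⟨
  d0 ∷ strip (binrev (suc b))    ∎
  where open ≡-Reasoning
binrev-odd b = trans (binrev-suc (b * 2)) (cong incRev (binrev-even b))

R : ℕ → ℕ → Str
R i j = iterate Trev i (binrev j)

iterate-T : ∀ i w → iterate T i w ≡ reverse (iterate Trev i (reverse w))
iterate-T zero    w = sym (reverse-involutive w)
iterate-T (suc i) w = begin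
  T (iterate T i w)                       ≡⟨ cong T (iterate-T i w) ⟩
  reverse (Trev (reverse (reverse rows)))  ≡⟨ cong (λ v → reverse (Trev v)) (reverse-involutive rows) ⟩
  reverse (Trev rows)                     ∎
  where
  open ≡-Reasoning
  rows : Str
  rows = iterate Trev i (reverse w)

G-reverse : ∀ i j → reverse (G i j) ≡ R i j
G-reverse i j = reverse-selfInverse (sym (iterate-T i (bin j)))

-- Concatenation with a final digit is prepending in reversed form; the
-- special reading of the prefix 0 is exactly the normalisation strip.
snoc-reverse : ∀ (w : Str) (d : Digit) → w ++ d ∷ [] ≡ reverse (d ∷ reverse w)
snoc-reverse w d = begin
  w ++ d ∷ []                   ≡⟨ cong (_++ d ∷ []) (reverse-involutive w) ⟨
  reverse (reverse w) ++ d ∷ [] ≡⟨ unfold-reverse d (reverse w) ⟨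
  reverse (d ∷ reverse w)       ∎
  where open ≡-Reasoning

cat-nonzero : ∀ (w : Str) (d : Digit) → ¬ (w ≡ d0 ∷ []) →
              w ++ d ∷ [] ≡ reverse (d ∷ strip (reverse w))
cat-nonzero w d w≢0 = trans (snoc-reverse w d) (cong (λ v → reverse (d ∷ v))
  (sym (strip-id (reverse w) (λ rw≡0 → w≢0 (sym (reverse-selfInverse rw≡0))))))

cat-reverse : ∀ (w : Str) (d : Digit) → cat w d ≡ reverse (d ∷ strip (reverse w))
cat-reverse (d0 ∷ [])      d = refl
cat-reverse []             d = refl
cat-reverse w@(d0 ∷ _ ∷ _) d = cat-nonzero w d (λ ())
cat-reverse w@(d1 ∷ _)     d = cat-nonzero w d (λ ())
cat-reverse w@(d2 ∷ _)     d = cat-nonzero w d (λ ())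

G-cat : ∀ i j i′ j′ {d} → R i j ≡ d ∷ strip (R i′ j′) → G i j ≡ cat (G i′ j′) d
G-cat i j i′ j′ {d} R≡ = begin
  G i j                                   ≡⟨ reverse-selfInverse (G-reverse i j) ⟨
  reverse (R i j)                         ≡⟨ cong reverse R≡ ⟩
  reverse (d ∷ strip (R i′ j′))           ≡⟨ cong (λ v → reverse (d ∷ strip v)) (G-reverse i′ j′) ⟨
  reverse (d ∷ strip (reverse (G i′ j′))) ≡⟨ cat-reverse (G i′ j′) d ⟨
  cat (G i′ j′) d                         ∎
  where open ≡-Reasoning

-- The six identities in reversed form, with rows 3a, 3a+1, 3a+2 and
-- columns 2b, 2b+1 written so that iterate and binrev unfold.
module ReversedZ (a b : ℕ) where

  -- row 3a: three steps per step of the prefix, which is row 2a of column b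
  upper : ∀ d → iterate Trev (a * 3) (d ∷ strip (binrev b)) ≡ d ∷ strip (R (a * 2) b)
  upper d = trans (cycle a d _) (cong (d ∷_) (iterate-commutes Trev-commutes (a * 2) (binrev b)))

  lower : Trev (strip (R (a * 2) b)) ≡ strip (R (suc (a * 2)) b)
  lower = Trev-commutes (R (a * 2) b)

  r00 : R (a * 3) (b * 2) ≡ d0 ∷ strip (R (a * 2) b)
  r00 = trans (cong (iterate Trev (a * 3)) (binrev-even b)) (upper d0)

  r01 : R (a * 3) (suc (b * 2)) ≡ d1 ∷ strip (R (a * 2) b)
  r01 = trans (cong (iterate Trev (a * 3)) (binrev-odd b)) (upper d1)

  -- further steps move the last digit 0 ↦ 2, 1 ↦ 0, 2 ↦ 1, the last two
  -- moving the prefix on by one step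
  r10 : R (suc (a * 3)) (b * 2) ≡ d2 ∷ strip (R (a * 2) b)
  r10 = cong Trev r00

  r11 : R (suc (a * 3)) (suc (b * 2)) ≡ d0 ∷ strip (R (suc (a * 2)) b)
  r11 = trans (cong Trev r01) (cong (d0 ∷_) lower)

  r20 : R (suc (suc (a * 3))) (b * 2) ≡ d1 ∷ strip (R (suc (a * 2)) b)
  r20 = trans (cong Trev r10) (cong (d1 ∷_) lower)

  r21 : R (suc (suc (a * 3))) (suc (b * 2)) ≡ d2 ∷ strip (R (suc (a * 2)) b)
  r21 = cong Trev r11

  G00 : G (a * 3) (b * 2) ≡ cat (G (a * 2) b) d0
  G00 = G-cat (a * 3) (b * 2) (a * 2) b r00

  G01 : G (a * 3) (suc (b * 2)) ≡ cat (G (a * 2) b) d1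
  G01 = G-cat (a * 3) (suc (b * 2)) (a * 2) b r01

  G10 : G (suc (a * 3)) (b * 2) ≡ cat (G (a * 2) b) d2
  G10 = G-cat (suc (a * 3)) (b * 2) (a * 2) b r10

  G11 : G (suc (a * 3)) (suc (b * 2)) ≡ cat (G (suc (a * 2)) b) d0
  G11 = G-cat (suc (a * 3)) (suc (b * 2)) (suc (a * 2)) b r11

  G20 : G (suc (suc (a * 3))) (b * 2) ≡ cat (G (suc (a * 2)) b) d1
  G20 = G-cat (suc (suc (a * 3))) (b * 2) (suc (a * 2)) b r20

  G21 : G (suc (suc (a * 3))) (suc (b * 2)) ≡ cat (G (suc (a * 2)) b) d2
  G21 = G-cat (suc (suc (a * 3))) (suc (b * 2)) (suc (a * 2)) b r21

corollary6 : (a b : ℕ) →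
    (G (3 * a) (2 * b) ≡ cat (G (2 * a) b) d0)
    × (G (3 * a) (2 * b + 1) ≡ cat (G (2 * a) b) d1)
    × (G (3 * a + 1) (2 * b) ≡ cat (G (2 * a) b) d2)
    × (G (3 * a + 1) (2 * b + 1) ≡ cat (G (2 * a + 1) b) d0)
    × (G (3 * a + 2) (2 * b) ≡ cat (G (2 * a + 1) b) d1)
    × (G (3 * a + 2) (2 * b + 1) ≡ cat (G (2 * a + 1) b) d2)
-- normalise the indices to the forms  suc (a * 3)  etc. used above
corollary6 a b
  rewrite *-comm 3 a | *-comm 2 a | *-comm 2 b
        | +-comm (a * 3) 1 | +-comm (a * 3) 2 | +-comm (b * 2) 1 | +-comm (a * 2) 1
  = G00 , G01 , G10 , G11 , G20 , G21
  where open ReversedZ a b
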